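{- Let $G$ be a graph, $x,y\in V(G)$ distinct, and $r$ a positive integer. If $G$ contains an $r$-compatible set of $4$ pairwise edge-disjoint $xy$-paths, then $G$ contains $C_{2,r}$ as an immersion.
   Context: Graphs are finite and loopless but may have multiple edges. Two edge-disjoint $xy$-paths $Q_1=x_1,\dots,x_s$ and $Q_2=y_1,\dots,y_t$ (with $x_1=y_1=x$, $x_s=y_t=y$) are aligned if for every two internal vertices $u=x_{i_1}=y_{j_1}$, $v=x_{i_2}=y_{j_2}$ in which they intersect, $(i_1-i_2)(j_1-j_2)>0$. A set of edge-disjoint $xy$-paths is $r$-compatible if some two of the paths are aligned and intersect in at least $r$ vertices (counting $x$ and $y$). $C_{2,r}$ is the cycle on $r$ vertices with each edge doubled. $H$ is (weakly) immersed in $G$ if there is an injective map $V(H)\to V(G)$ and an assignment to each edge $uv$ of $H$ of a path in $G$ between the images of $u,v$, pairwise edge-disjoint. -}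

module Defs where

open import Data.Nat using (ℕ; zero; suc; _+_; _≤_; _<_)
import Data.Nat as ℕ
open import Data.Fin using (Fin; zero; suc; toℕ; lower₁; splitAt)
import Data.Fin as F
open import Data.Fin.Properties using (_≟_)
open import Data.List using (List; []; _∷_; length; lookup)
open import Data.List.Relation.Unary.All using (All)
open import Data.List.Relation.Unary.Unique.Propositional using (Unique)
open import Data.List.Membership.Propositional using (_∈_; _∉_)
open import Data.Product using (Σ; ∃; ∃-syntax; _×_; _,_; proj₁; proj₂)
open import Data.Sum using (_⊎_; inj₁; inj₂; [_,_])
open import Relation.Binary.PropositionalEquality using (_≡_; _≢_; refl; sym)
open import Relation.Nullary using (yes; no)
open import Function.Definitions using (Injective)

-- A finite multigraph: vertices Fin nV, edges Fin nE, each edge with an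
-- (unordered) pair of ends.  Loops are allowed by the record itself;
-- looplessness is the separate predicate Loopless.
record Multigraph : Set where
  field
    nV   : ℕ
    nE   : ℕ
    ends : Fin nE → Fin nV × Fin nV

open Multigraph public

Vtx : Multigraph → Set
Vtx G = Fin (nV G)

Edge : Multigraph → Set
Edge G = Fin (nE G)

Loopless : Multigraph → Set
Loopless G = (e : Edge G) → proj₁ (ends G e) ≢ proj₂ (ends G e)

module _ (G : Multigraph) where

  Joins : Edge G → Vtx G → Vtx G → Set
  Joins e u w = (ends G e ≡ (u , w)) ⊎ (ends G e ≡ (w , u))

  data Walk : Vtx G → Vtx G → Set where
    nil  : ∀ {v} → Walk v v
    cons : ∀ {u w v} (e : Edge G) → Joins e u w → Walk w v → Walk u v

  verts : ∀ {u v} → Walk u v → List (Vtx G)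
  verts (nil {v})        = v ∷ []
  verts (cons {u} e _ p) = u ∷ verts p

  edges : ∀ {u v} → Walk u v → List (Edge G)
  edges nil          = []
  edges (cons e _ p) = e ∷ edges p

  record Path (x y : Vtx G) : Set where
    field
      walk     : Walk x y
      distinct : Unique (verts walk)

  open Path public

  EdgeDisjoint : ∀ {a b c d} → Path a b → Path c d → Set
  EdgeDisjoint P Q = ∀ e → e ∈ edges (walk P) → e ∉ edges (walk Q)

  Internal : (vs : List (Vtx G)) → Fin (length vs) → Set
  Internal vs i = (0 < toℕ i) × (suc (toℕ i) < length vs)

  -- aligned: for any two distinct internal vertices u, v common to both
  -- paths, u at positions i1 (in P), j1 (in Q) and v at i2, j2, we have
  -- (i1 - i2)(j1 - j2) > 0, i.e. both orders agree strictly.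
  Aligned : ∀ {x y} → Path x y → Path x y → Set
  Aligned P Q =
    (i₁ i₂ : Fin (length (verts (walk P)))) →
    (j₁ j₂ : Fin (length (verts (walk Q)))) →
    Internal (verts (walk P)) i₁ → Internal (verts (walk P)) i₂ →
    Internal (verts (walk Q)) j₁ → Internal (verts (walk Q)) j₂ →
    lookup (verts (walk P)) i₁ ≡ lookup (verts (walk Q)) j₁ →
    lookup (verts (walk P)) i₂ ≡ lookup (verts (walk Q)) j₂ →
    lookup (verts (walk P)) i₁ ≢ lookup (verts (walk P)) i₂ →
    ((toℕ i₁ < toℕ i₂) × (toℕ j₁ < toℕ j₂)) ⊎ ((toℕ i₂ < toℕ i₁) × (toℕ j₂ < toℕ j₁))

  -- P and Q share at least r vertices (x and y included)
  IntersectAtLeast : ∀ {x y} → ℕ → Path x y → Path x y → Set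
  IntersectAtLeast r P Q =
    ∃[ L ] (Unique L × r ≤ length L ×
            All (λ v → (v ∈ verts (walk P)) × (v ∈ verts (walk Q))) L)

  PairwiseEdgeDisjoint : ∀ {x y k} → (Fin k → Path x y) → Set
  PairwiseEdgeDisjoint Ps = ∀ i j → i ≢ j → EdgeDisjoint (Ps i) (Ps j)

  Compatible : ∀ {x y k} → ℕ → (Fin k → Path x y) → Set
  Compatible r Ps =
    ∃[ i ] ∃[ j ] (i ≢ j × Aligned (Ps i) (Ps j) × IntersectAtLeast r (Ps i) (Ps j))

-- (weak) immersion of H in G
Immersion : Multigraph → Multigraph → Set
Immersion H G =
  Σ (Vtx H → Vtx G) λ f → Injective _≡_ _≡_ f ×
  Σ ((e : Edge H) → Path G (f (proj₁ (ends H e))) (f (proj₂ (ends H e)))) λ π →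
    ∀ e e′ → e ≢ e′ → EdgeDisjoint G (π e) (π e′)

cyc : ∀ {n} → Fin n → Fin n
cyc {suc n} i with toℕ i ℕ.≟ n
... | yes _ = zero
... | no ne = suc (lower₁ i (λ eq → ne (sym eq)))

-- C_{2,r}: cycle on r vertices (0,1,...,r-1,0) with every edge doubled;
-- edges Fin (r + r), edge copies i and r+i both join i and i+1 mod r.
C2 : ℕ → Multigraph
C2 r = record
  { nV   = r
  ; nE   = r + r
  ; ends = λ e → [ (λ i → i , cyc i) , (λ i → i , cyc i) ] (splitAt r e)
  }

{-# OPTIONS --safe #-}
-- Alignment says that the common vertices of the two aligned paths P and Q occur in the
-- same order along both, so the first r of them, x = s₀, s₁, …, s_{r-1}, form a common
-- subsequence of the vertex sequences of P and Q.  Cutting P at these vertices and returning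
-- from y to x along a third path gives edge-disjoint walks sᵢ → sᵢ₊₁ (indices mod r); doing
-- the same with Q and the fourth path gives a second such family, edge-disjoint from the
-- first.  Shortcutting each walk to a path yields the 2r paths of an immersion of C_{2,r}.
module Submission where

open import Data.Empty using (⊥-elim)
open import Data.Fin using (Fin; zero; suc; toℕ; fromℕ; inject₁; splitAt; join; punchIn; punchOut)
open import Data.Fin.Properties
  using (_≟_; injective⇒≤; toℕ-fromℕ; toℕ-inject₁-≢; lower₁-inject₁′; join-splitAt; 0≢1+n;
         punchInᵢ≢i; punchIn-injective; punchIn-punchOut)
open import Data.Fin.Relation.Unary.Top using (view; ‵fromℕ; ‵inject₁)
open import Data.List using (List; []; _∷_; length; lookup; _++_; drop; take; filter)
open import Data.List.Properties using (length-take; ++-assoc)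
import Data.List.Membership.DecPropositional as DecMembership
open import Data.List.Membership.Propositional using (_∈_; _∉_)
open import Data.List.Membership.Propositional.Properties
  using (∈-lookup; ∈-++⁻; ∈-++⁺ˡ; ∈-++⁺ʳ; ∈-filter⁺)
open import Data.List.Relation.Binary.Disjoint.Propositional using (Disjoint)
open import Data.List.Relation.Binary.Sublist.Propositional
  using (_⊆_; []; _∷_; _∷ʳ_; to∈; from∈; minimum; ⊆-refl; ⊆-trans)
open import Data.List.Relation.Binary.Sublist.Propositional.Properties
  using (Any-resp-⊆; ∷⁻; ∷ʳ⁻; ∷ˡ⁻; filter-⊆; take-⊆; ++⁺ˡ)
open import Data.List.Relation.Unary.All as All using (All; []; _∷_)
open import Data.List.Relation.Unary.All.Properties using (¬Any⇒All¬; All¬⇒¬Any; all-filter)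
open import Data.List.Relation.Unary.AllPairs as AllPairs using (AllPairs; []; _∷_)
open import Data.List.Relation.Unary.Any as Any using (here; there)
open import Data.List.Relation.Unary.Any.Properties using (lookup-index)
open import Data.List.Relation.Unary.Unique.Propositional using (Unique)
open import Data.List.Relation.Unary.Unique.Propositional.Properties using (++⁺)
open import Data.Nat using (ℕ; suc; _≤_; _<_; z≤n; s≤s; s≤s⁻¹)
import Data.Nat as ℕ
open import Data.Nat.Properties using (<-irrefl; <-asym; ≤-trans; m≤n⇒m⊓n≡m)
open import Data.Product using (Σ; ∃; ∃₂; _×_; _,_; proj₁; proj₂)
open import Data.Sum using (_⊎_; inj₁; inj₂; swap; [_,_]′)
open import Function using (_∘_)
open import Function.Definitions using (Injective)
open import Relation.Binary.Definitions using (DecidableEquality)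
open import Relation.Binary.PropositionalEquality
  using (_≡_; _≢_; refl; sym; trans; cong; subst; subst₂; module ≡-Reasoning)
open import Relation.Nullary using (Dec; yes; no)

open import Defs

module _ {A : Set} where

  Unique⇒lookup-injective : ∀ {xs : List A} → Unique xs →
    ∀ {i j} → lookup xs i ≡ lookup xs j → i ≡ j
  Unique⇒lookup-injective {_ ∷ _}  _          {zero}  {zero}  _  = refl
  Unique⇒lookup-injective {_ ∷ xs} (x∉ ∷ _)   {zero}  {suc j} eq = ⊥-elim (All.lookup x∉ (∈-lookup j) eq)
  Unique⇒lookup-injective {_ ∷ xs} (x∉ ∷ _)   {suc i} {zero}  eq = ⊥-elim (All.lookup x∉ (∈-lookup i) (sym eq))
  Unique⇒lookup-injective {_ ∷ _}  (_ ∷ uxs)  {suc i} {suc j} eq = cong suc (Unique⇒lookup-injective uxs eq)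

  Unique⇒length≤ : ∀ {xs ys : List A} → Unique xs → (∀ {v} → v ∈ xs → v ∈ ys) →
    length xs ≤ length ys
  Unique⇒length≤ {xs} {ys} uxs xs⊆ys = injective⇒≤ position-injective
    where
    position : Fin (length xs) → Fin (length ys)
    position i = Any.index (xs⊆ys (∈-lookup i))
    position-injective : ∀ {i j} → position i ≡ position j → i ≡ j
    position-injective {i} {j} eq = Unique⇒lookup-injective uxs (begin
      lookup xs i            ≡⟨ lookup-index (xs⊆ys (∈-lookup i)) ⟩
      lookup ys (position i) ≡⟨ cong (lookup ys) eq ⟩
      lookup ys (position j) ≡⟨ lookup-index (xs⊆ys (∈-lookup j)) ⟨
      lookup xs j            ∎)
      where open ≡-Reasoning

  Unique-resp-⊆ : ∀ {xs ys : List A} → xs ⊆ ys → Unique ys → Unique xs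
  Unique-resp-⊆ []         _           = []
  Unique-resp-⊆ (y ∷ʳ p)   (_ ∷ uys)   = Unique-resp-⊆ p uys
  Unique-resp-⊆ (refl ∷ p) (y∉ ∷ uys)  =
    All.tabulate (λ v∈xs → All.lookup y∉ (Any-resp-⊆ p v∈xs)) ∷ Unique-resp-⊆ p uys

  Unique-++⁻ʳ : ∀ (xs : List A) {ys} → Unique (xs ++ ys) → Unique ys
  Unique-++⁻ʳ xs = Unique-resp-⊆ (++⁺ˡ xs ⊆-refl)

  Unique-++⁻-disjoint : ∀ (xs : List A) {ys} → Unique (xs ++ ys) → Disjoint xs ys
  Unique-++⁻-disjoint (x ∷ xs) (x∉ ∷ _) (here refl , v∈ys) = All.lookup x∉ (∈-++⁺ʳ xs v∈ys) refl
  Unique-++⁻-disjoint (x ∷ xs) (_ ∷ u)  (there v∈xs , v∈ys) = Unique-++⁻-disjoint xs u (v∈xs , v∈ys)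

  Precedes : List A → A → A → Set
  Precedes xs u v = u ∷ v ∷ [] ⊆ xs

  lookup-Precedes : ∀ (xs : List A) {i j} → toℕ i < toℕ j → Precedes xs (lookup xs i) (lookup xs j)
  lookup-Precedes (x ∷ xs) {zero}  {suc j} _         = refl ∷ from∈ (∈-lookup j)
  lookup-Precedes (x ∷ xs) {suc i} {suc j} (s≤s i<j) = x ∷ʳ lookup-Precedes xs i<j

  Precedes⇒lookup : ∀ {xs : List A} {u v} → Precedes xs u v →
    ∃₂ λ i j → toℕ i < toℕ j × lookup xs i ≡ u × lookup xs j ≡ v
  Precedes⇒lookup (x ∷ʳ p) with Precedes⇒lookup p
  ... | i , j , i<j , xsᵢ≡u , xsⱼ≡v = suc i , suc j , s≤s i<j , xsᵢ≡u , xsⱼ≡v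
  Precedes⇒lookup (refl ∷ p) =
    zero , suc (Any.index (to∈ p)) , s≤s z≤n , refl , sym (lookup-index (to∈ p))

  ⊆⇒AllPairs-Precedes : ∀ {xs ys : List A} → xs ⊆ ys → AllPairs (Precedes ys) xs
  ⊆⇒AllPairs-Precedes []         = []
  ⊆⇒AllPairs-Precedes (y ∷ʳ p)   = AllPairs.map (y ∷ʳ_) (⊆⇒AllPairs-Precedes p)
  ⊆⇒AllPairs-Precedes (refl ∷ p) =
    All.tabulate (λ v∈xs → refl ∷ from∈ (Any-resp-⊆ p v∈xs)) ∷
    AllPairs.map (_ ∷ʳ_) (⊆⇒AllPairs-Precedes p)

  Precedes-∷⁻ : ∀ {b u v} {ys : List A} → Precedes (b ∷ ys) u v → v ∈ ys
  Precedes-∷⁻ p = to∈ (∷⁻ p)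

  module _ (_≟_ : DecidableEquality A) where

    private
      stripHead : ∀ {b} {ys xs : List A} → All (b ≢_) ys → All (_∈ ys) xs →
        AllPairs (Precedes (b ∷ ys)) xs → AllPairs (Precedes ys) xs
      stripHead b∉ys []          []       = []
      stripHead b∉ys (u∈ys ∷ ∈ys) (p ∷ ps) =
        All.map (∷ʳ⁻ (λ u≡b → All.lookup b∉ys u∈ys (sym u≡b))) p ∷ stripHead b∉ys ∈ys ps

    ordered⇒⊆ : ∀ {xs ys : List A} → Unique ys → All (_∈ ys) xs →
      AllPairs (Precedes ys) xs → xs ⊆ ys
    ordered⇒⊆ {[]}    {ys}     _ _ _ = minimum ys
    ordered⇒⊆ {_ ∷ _} {[]}     _ (() ∷ _) _
    ordered⇒⊆ {a ∷ xs} {b ∷ ys} (b∉ys ∷ uys) (a∈ ∷ _) (a≺xs ∷ xs≺) with a ≟ b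
    ... | yes refl = refl ∷ ordered⇒⊆ uys xs∈ys (stripHead b∉ys xs∈ys xs≺)
      where xs∈ys = All.map Precedes-∷⁻ a≺xs
    ... | no a≢b   = b ∷ʳ ordered⇒⊆ uys a∷xs∈ys (stripHead b∉ys a∷xs∈ys (a≺xs ∷ xs≺))
      where a∷xs∈ys = Any.tail a≢b a∈ ∷ All.map Precedes-∷⁻ a≺xs

cyc-fromℕ : ∀ n → cyc (fromℕ n) ≡ zero
cyc-fromℕ n with toℕ (fromℕ n) ℕ.≟ n
... | yes _   = refl
... | no  ≢n = ⊥-elim (≢n (toℕ-fromℕ n))

cyc-inject₁ : ∀ {n} (i : Fin n) → cyc (inject₁ i) ≡ suc i
cyc-inject₁ {n} i with toℕ (inject₁ i) ℕ.≟ n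
... | yes ≡n = ⊥-elim (toℕ-inject₁-≢ i (sym ≡n))
... | no  ≢n = cong suc (lower₁-inject₁′ i (≢n ∘ sym))

module _ {G : Multigraph} where

  private
    variable
      a b c u v : Vtx G
      e : Edge G
      S : List (Vtx G)

  open DecMembership (_≟_ {nV G}) using (_∈?_)

  start∈verts : (w : Walk G a b) → a ∈ verts G w
  start∈verts nil          = here refl
  start∈verts (cons _ _ _) = here refl

  end∈verts : (w : Walk G a b) → b ∈ verts G w
  end∈verts nil          = here refl
  end∈verts (cons _ _ w) = there (end∈verts w)

  _++ʷ_ : Walk G a b → Walk G b c → Walk G a c
  nil        ++ʷ w′ = w′
  cons e j w ++ʷ w′ = cons e j (w ++ʷ w′)

  edges-++ʷ : (w : Walk G a b) (w′ : Walk G b c) → edges G (w ++ʷ w′) ≡ edges G w ++ edges G w′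
  edges-++ʷ nil          w′ = refl
  edges-++ʷ (cons e _ w) w′ = cong (e ∷_) (edges-++ʷ w w′)

  reverseʷ : Walk G a b → Walk G b a
  reverseʷ nil          = nil
  reverseʷ (cons e j w) = reverseʷ w ++ʷ cons e (swap j) nil

  ∈-edges-reverseʷ⁻ : (w : Walk G a b) → e ∈ edges G (reverseʷ w) → e ∈ edges G w
  ∈-edges-reverseʷ⁻ (cons e j w) e′∈
    with ∈-++⁻ (edges G (reverseʷ w))
           (subst (_ ∈_) (edges-++ʷ (reverseʷ w) (cons e (swap j) nil)) e′∈)
  ... | inj₁ e′∈w        = there (∈-edges-reverseʷ⁻ w e′∈w)
  ... | inj₂ (here refl) = here refl

  dropUntil : (w : Walk G a b) → v ∈ verts G w → Walk G v b
  dropUntil nil          (here refl)  = nil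
  dropUntil (cons e j w) (here refl)  = cons e j w
  dropUntil (cons _ _ w) (there v∈w) = dropUntil w v∈w

  verts-dropUntil : (w : Walk G a b) (v∈w : v ∈ verts G w) → verts G (dropUntil w v∈w) ⊆ verts G w
  verts-dropUntil nil          (here refl)  = ⊆-refl
  verts-dropUntil (cons e j w) (here refl)  = ⊆-refl
  verts-dropUntil (cons _ _ w) (there v∈w) = _ ∷ʳ verts-dropUntil w v∈w

  edges-dropUntil : (w : Walk G a b) (v∈w : v ∈ verts G w) → edges G (dropUntil w v∈w) ⊆ edges G w
  edges-dropUntil nil          (here refl)  = ⊆-refl
  edges-dropUntil (cons e j w) (here refl)  = ⊆-refl
  edges-dropUntil (cons e _ w) (there v∈w) = e ∷ʳ edges-dropUntil w v∈w

  shortcut : Walk G a b → Walk G a b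
  shortcut nil = nil
  shortcut {a} (cons e j w) with a ∈? verts G (shortcut w)
  ... | yes a∈w = dropUntil (shortcut w) a∈w
  ... | no  _   = cons e j (shortcut w)

  Unique-verts-shortcut : (w : Walk G a b) → Unique (verts G (shortcut w))
  Unique-verts-shortcut nil = [] ∷ []
  Unique-verts-shortcut {a} (cons e j w) with a ∈? verts G (shortcut w)
  ... | yes a∈w = Unique-resp-⊆ (verts-dropUntil (shortcut w) a∈w) (Unique-verts-shortcut w)
  ... | no  a∉w = ¬Any⇒All¬ _ a∉w ∷ Unique-verts-shortcut w

  edges-shortcut : (w : Walk G a b) → edges G (shortcut w) ⊆ edges G w
  edges-shortcut nil = []
  edges-shortcut {a} (cons e j w) with a ∈? verts G (shortcut w)
  ... | yes a∈w = e ∷ʳ ⊆-trans (edges-dropUntil (shortcut w) a∈w) (edges-shortcut w)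
  ... | no  _   = refl ∷ edges-shortcut w

  shortcutPath : Walk G a b → Path G a b
  shortcutPath w = record { walk = shortcut w ; distinct = Unique-verts-shortcut w }

  joins-ends : Joins G e u v → Joins G e a b → u ≡ a ⊎ u ≡ b
  joins-ends (inj₁ p) (inj₁ q) = inj₁ (cong proj₁ (trans (sym p) q))
  joins-ends (inj₁ p) (inj₂ q) = inj₂ (cong proj₁ (trans (sym p) q))
  joins-ends (inj₂ p) (inj₁ q) = inj₂ (cong proj₂ (trans (sym p) q))
  joins-ends (inj₂ p) (inj₂ q) = inj₁ (cong proj₂ (trans (sym p) q))

  joins-∈-verts : Joins G e u v → (w : Walk G a b) → e ∈ edges G w → u ∈ verts G w
  joins-∈-verts e:uv (cons e j w) (here refl) with joins-ends e:uv j
  ... | inj₁ refl = here refl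
  ... | inj₂ refl = there (start∈verts w)
  joins-∈-verts e:uv (cons _ _ w) (there e∈w) = there (joins-∈-verts e:uv w e∈w)

  Unique-edges : (w : Walk G a b) → Unique (verts G w) → Unique (edges G w)
  Unique-edges nil          _           = []
  Unique-edges (cons e j w) (a∉w ∷ uw) =
    ¬Any⇒All¬ _ (λ e∈w → All¬⇒¬Any a∉w (joins-∈-verts j w e∈w)) ∷ Unique-edges w uw

  verts-∷-drop : (w : Walk G a b) → verts G w ≡ a ∷ drop 1 (verts G w)
  verts-∷-drop nil          = refl
  verts-∷-drop (cons _ _ _) = refl

  lookup≡start⇒first : (w : Walk G a b) → Unique (verts G w) → ∀ {i j} →
    lookup (verts G w) i ≡ a → lookup (verts G w) j ≢ a → toℕ i < toℕ j
  lookup≡start⇒first nil          _          {zero}  {zero}  _  ≢a = ⊥-elim (≢a refl)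
  lookup≡start⇒first (cons _ _ _) _          {zero}  {zero}  _  ≢a = ⊥-elim (≢a refl)
  lookup≡start⇒first (cons _ _ _) _          {zero}  {suc _} _  _  = s≤s z≤n
  lookup≡start⇒first (cons _ _ _) (a∉w ∷ _) {suc i} {_}     ≡a _  =
    ⊥-elim (All.lookup a∉w (∈-lookup i) (sym ≡a))

  lookup≡end⇒last : (w : Walk G a b) → Unique (verts G w) → ∀ {i j} →
    lookup (verts G w) i ≡ b → lookup (verts G w) j ≢ b → toℕ j < toℕ i
  lookup≡end⇒last nil          _           {zero}  {zero}  _    ≢b = ⊥-elim (≢b refl)
  lookup≡end⇒last (cons _ _ w) (a∉w ∷ _)  {zero}  {_}     refl _  = ⊥-elim (All¬⇒¬Any a∉w (end∈verts w))
  lookup≡end⇒last (cons _ _ _) _           {suc _} {zero}  _    _  = s≤s z≤n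
  lookup≡end⇒last (cons _ _ w) (_ ∷ uw)    {suc _} {suc _} ≡b   ≢b = s≤s (lookup≡end⇒last w uw ≡b ≢b)

  lookup≢end⇒<length : (w : Walk G a b) → ∀ {i} →
    lookup (verts G w) i ≢ b → suc (toℕ i) < length (verts G w)
  lookup≢end⇒<length nil                     {zero}  ≢b = ⊥-elim (≢b refl)
  lookup≢end⇒<length (cons _ _ nil)          {zero}  _  = s≤s (s≤s z≤n)
  lookup≢end⇒<length (cons _ _ (cons _ _ _)) {zero}  _  = s≤s (s≤s z≤n)
  lookup≢end⇒<length (cons _ _ w)            {suc _} ≢b = s≤s (lookup≢end⇒<length w ≢b)

  lookup≢ends⇒Internal : (w : Walk G a b) → ∀ {i} →
    lookup (verts G w) i ≢ a → lookup (verts G w) i ≢ b → Internal G (verts G w) i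
  lookup≢ends⇒Internal nil            {zero}  ≢a _  = ⊥-elim (≢a refl)
  lookup≢ends⇒Internal (cons _ _ _)   {zero}  ≢a _  = ⊥-elim (≢a refl)
  lookup≢ends⇒Internal w@(cons _ _ _) {suc _} _  ≢b = s≤s z≤n , lookup≢end⇒<length w ≢b

  module _ {x y : Vtx G} (P Q : Path G x y) (aligned : Aligned G P Q) where

    private
      Pv Qv : List (Vtx G)
      Pv = verts G (walk P)
      Qv = verts G (walk Q)

    -- Aligned only constrains internal vertices; a common vertex equal to x (resp. y)
    -- comes first (resp. last) on both paths.
    Aligned⇒order-preserving : ∀ {i₁ i₂ j₁ j₂} → toℕ i₁ < toℕ i₂ →
      lookup Pv i₁ ≡ lookup Qv j₁ → lookup Pv i₂ ≡ lookup Qv j₂ → toℕ j₁ < toℕ j₂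
    Aligned⇒order-preserving {i₁} {i₂} {j₁} {j₂} i₁<i₂ p₁≡q₁ p₂≡q₂ =
      byEnds (lookup Pv i₁ ≟ x) (lookup Pv i₂ ≟ y)
      where
      p₁≢p₂ : lookup Pv i₁ ≢ lookup Pv i₂
      p₁≢p₂ eq = <-irrefl (cong toℕ (Unique⇒lookup-injective (distinct P) eq)) i₁<i₂

      byEnds : Dec (lookup Pv i₁ ≡ x) → Dec (lookup Pv i₂ ≡ y) → toℕ j₁ < toℕ j₂
      byEnds (yes p₁≡x) _ = lookup≡start⇒first (walk Q) (distinct Q) (trans (sym p₁≡q₁) p₁≡x)
        (λ q₂≡x → p₁≢p₂ (trans p₁≡x (sym (trans p₂≡q₂ q₂≡x))))
      byEnds (no _) (yes p₂≡y) = lookup≡end⇒last (walk Q) (distinct Q) (trans (sym p₂≡q₂) p₂≡y)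
        (λ q₁≡y → p₁≢p₂ (trans (trans p₁≡q₁ q₁≡y) (sym p₂≡y)))
      byEnds (no p₁≢x) (no p₂≢y) =
        [ proj₂ , (λ (i₂<i₁ , _) → ⊥-elim (<-asym i₁<i₂ i₂<i₁)) ]′
          (aligned i₁ i₂ j₁ j₂
            (lookup≢ends⇒Internal (walk P) p₁≢x p₁≢y) (lookup≢ends⇒Internal (walk P) p₂≢x p₂≢y)
            (lookup≢ends⇒Internal (walk Q) (p₁≢x ∘ trans p₁≡q₁) (p₁≢y ∘ trans p₁≡q₁))
            (lookup≢ends⇒Internal (walk Q) (p₂≢x ∘ trans p₂≡q₂) (p₂≢y ∘ trans p₂≡q₂))
            p₁≡q₁ p₂≡q₂ p₁≢p₂)
        where
        p₁≢y : lookup Pv i₁ ≢ y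
        p₁≢y p₁≡y = <-asym i₁<i₂ (lookup≡end⇒last (walk P) (distinct P) p₁≡y p₂≢y)
        p₂≢x : lookup Pv i₂ ≢ x
        p₂≢x p₂≡x = <-asym i₁<i₂ (lookup≡start⇒first (walk P) (distinct P) p₂≡x p₁≢x)

    Aligned⇒Precedes : u ∈ Qv → v ∈ Qv → Precedes Pv u v → Precedes Qv u v
    Aligned⇒Precedes u∈Q v∈Q u≺v with Precedes⇒lookup u≺v
    ... | i₁ , i₂ , i₁<i₂ , refl , refl =
      subst₂ (Precedes Qv) (sym (lookup-index u∈Q)) (sym (lookup-index v∈Q))
        (lookup-Precedes Qv (Aligned⇒order-preserving i₁<i₂ (lookup-index u∈Q) (lookup-index v∈Q)))

    Aligned⇒AllPairs-Precedes : ∀ {zs} → All (_∈ Qv) zs →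
      AllPairs (Precedes Pv) zs → AllPairs (Precedes Qv) zs
    Aligned⇒AllPairs-Precedes []           []           = []
    Aligned⇒AllPairs-Precedes (u∈Q ∷ zs∈Q) (u≺zs ∷ zs≺) =
      All.zipWith (λ (v∈Q , u≺v) → Aligned⇒Precedes u∈Q v∈Q u≺v) (zs∈Q , u≺zs) ∷
      Aligned⇒AllPairs-Precedes zs∈Q zs≺

    Aligned⇒commonSublist : ∀ {n} → IntersectAtLeast G (suc n) P Q →
      ∃ λ S → length S ≡ n × Unique (x ∷ S) × S ⊆ Pv × S ⊆ Qv
    Aligned⇒commonSublist {n} (L , uL , 1+n≤L , L⊆P∩Q) =
      take n K , trans (length-take n K) (m≤n⇒m⊓n≡m n≤K) ,
      Unique-resp-⊆ xS⊆P (distinct P) , ∷ˡ⁻ xS⊆P , ∷ˡ⁻ (⊆-trans xS⊆xK xK⊆Q)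
      where
      K = filter (_∈? Qv) (drop 1 Pv)

      xK⊆P : x ∷ K ⊆ Pv
      xK⊆P = subst (x ∷ K ⊆_) (sym (verts-∷-drop (walk P)))
        (refl ∷ filter-⊆ (_∈? Qv) (drop 1 Pv))

      xK∈Q : All (_∈ Qv) (x ∷ K)
      xK∈Q = start∈verts (walk Q) ∷ all-filter (_∈? Qv) (drop 1 Pv)

      xK⊆Q : x ∷ K ⊆ Qv
      xK⊆Q = ordered⇒⊆ _≟_ (distinct Q) xK∈Q
        (Aligned⇒AllPairs-Precedes xK∈Q (⊆⇒AllPairs-Precedes xK⊆P))

      L⊆xK : ∀ {v} → v ∈ L → v ∈ x ∷ K
      L⊆xK v∈L with All.lookup L⊆P∩Q v∈L
      ... | v∈P , v∈Q with subst (_ ∈_) (verts-∷-drop (walk P)) v∈P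
      ...   | here v≡x   = here v≡x
      ...   | there v∈ps = there (∈-filter⁺ (_∈? Qv) v∈ps v∈Q)

      n≤K : n ≤ length K
      n≤K = s≤s⁻¹ (≤-trans 1+n≤L (Unique⇒length≤ uL L⊆xK))

      xS⊆xK : x ∷ take n K ⊆ x ∷ K
      xS⊆xK = refl ∷ take-⊆ n K

      xS⊆P : x ∷ take n K ⊆ Pv
      xS⊆P = ⊆-trans xS⊆xK xK⊆P

  infixr 5 _▸_

  data Chain : Vtx G → List (Vtx G) → Vtx G → Set where
    end : Walk G a b → Chain a [] b
    _▸_ : Walk G a v → Chain v S b → Chain a (v ∷ S) b

  chainEdges : Chain a S b → List (Edge G)
  chainEdges (end w)  = edges G w
  chainEdges (w ▸ ch) = edges G w ++ chainEdges ch

  consᶜ : (e : Edge G) → Joins G e a u → Chain u S b → Chain a S b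
  consᶜ e j (end w)  = end (cons e j w)
  consᶜ e j (w ▸ ch) = cons e j w ▸ ch

  chainEdges-consᶜ : (j : Joins G e a u) (ch : Chain u S b) →
    chainEdges (consᶜ e j ch) ≡ e ∷ chainEdges ch
  chainEdges-consᶜ j (end w)  = refl
  chainEdges-consᶜ j (w ▸ ch) = refl

  split : (w : Walk G a b) → S ⊆ verts G w → Chain a S b
  split nil          (_ ∷ʳ [])    = end nil
  split nil          (refl ∷ [])  = nil ▸ end nil
  split (cons e j w) (_ ∷ʳ S⊆w)   = consᶜ e j (split w S⊆w)
  split (cons e j w) (refl ∷ S⊆w) = nil ▸ consᶜ e j (split w S⊆w)

  chainEdges-split : (w : Walk G a b) (S⊆w : S ⊆ verts G w) →
    chainEdges (split w S⊆w) ≡ edges G w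
  chainEdges-split nil          (_ ∷ʳ [])    = refl
  chainEdges-split nil          (refl ∷ [])  = refl
  chainEdges-split (cons e j w) (_ ∷ʳ S⊆w)   =
    trans (chainEdges-consᶜ j (split w S⊆w)) (cong (e ∷_) (chainEdges-split w S⊆w))
  chainEdges-split (cons e j w) (refl ∷ S⊆w) =
    trans (chainEdges-consᶜ j (split w S⊆w)) (cong (e ∷_) (chainEdges-split w S⊆w))

  extend : Chain a S b → Walk G b c → Chain a S c
  extend (end w)  w′ = end (w ++ʷ w′)
  extend (w ▸ ch) w′ = w ▸ extend ch w′

  chainEdges-extend : (ch : Chain a S b) (w′ : Walk G b c) →
    chainEdges (extend ch w′) ≡ chainEdges ch ++ edges G w′
  chainEdges-extend (end w)  w′ = edges-++ʷ w w′
  chainEdges-extend (w ▸ ch) w′ = begin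
    edges G w ++ chainEdges (extend ch w′)        ≡⟨ cong (edges G w ++_) (chainEdges-extend ch w′) ⟩
    edges G w ++ (chainEdges ch ++ edges G w′)    ≡⟨ ++-assoc (edges G w) (chainEdges ch) (edges G w′) ⟨
    (edges G w ++ chainEdges ch) ++ edges G w′    ∎
    where open ≡-Reasoning

  pieceEnd : (S : List (Vtx G)) → Vtx G → Fin (suc (length S)) → Vtx G
  pieceEnd []      b zero    = b
  pieceEnd (v ∷ S) b zero    = v
  pieceEnd (v ∷ S) b (suc i) = pieceEnd S b i

  piece : Chain a S b → (i : Fin (suc (length S))) → Walk G (lookup (a ∷ S) i) (pieceEnd S b i)
  piece (end w)  zero    = w
  piece (w ▸ ch) zero    = w
  piece (w ▸ ch) (suc i) = piece ch i

  piece-⊆ : (ch : Chain a S b) (i : Fin (suc (length S))) →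
    e ∈ edges G (piece ch i) → e ∈ chainEdges ch
  piece-⊆ (end w)  zero    e∈ = e∈
  piece-⊆ (w ▸ ch) zero    e∈ = ∈-++⁺ˡ e∈
  piece-⊆ (w ▸ ch) (suc i) e∈ = ∈-++⁺ʳ (edges G w) (piece-⊆ ch i e∈)

  pieces-disjoint : (ch : Chain a S b) → Unique (chainEdges ch) → ∀ i j → i ≢ j →
    e ∈ edges G (piece ch i) → e ∉ edges G (piece ch j)
  pieces-disjoint (end w)  _  zero    zero    i≢j = ⊥-elim (i≢j refl)
  pieces-disjoint (w ▸ ch) _  zero    zero    i≢j = ⊥-elim (i≢j refl)
  pieces-disjoint (w ▸ ch) u  zero    (suc j) _   e∈w e∈ch =
    Unique-++⁻-disjoint (edges G w) u (e∈w , piece-⊆ ch j e∈ch)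
  pieces-disjoint (w ▸ ch) u  (suc i) zero    _   e∈ch e∈w =
    Unique-++⁻-disjoint (edges G w) u (e∈w , piece-⊆ ch i e∈ch)
  pieces-disjoint (w ▸ ch) u  (suc i) (suc j) i≢j =
    pieces-disjoint ch (Unique-++⁻ʳ (edges G w) u) i j (i≢j ∘ cong suc)

  pieceEnd-fromℕ : ∀ (S : List (Vtx G)) b → pieceEnd S b (fromℕ (length S)) ≡ b
  pieceEnd-fromℕ []      b = refl
  pieceEnd-fromℕ (v ∷ S) b = pieceEnd-fromℕ S b

  pieceEnd-inject₁ : ∀ (S : List (Vtx G)) b (i : Fin (length S)) →
    pieceEnd S b (inject₁ i) ≡ lookup S i
  pieceEnd-inject₁ (v ∷ S) b zero    = refl
  pieceEnd-inject₁ (v ∷ S) b (suc i) = pieceEnd-inject₁ S b i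

  pieceEnd-cyc : ∀ (S : List (Vtx G)) a i → pieceEnd S a i ≡ lookup (a ∷ S) (cyc i)
  pieceEnd-cyc S a i with view i
  ... | ‵fromℕ     = trans (pieceEnd-fromℕ S a) (cong (lookup (a ∷ S)) (sym (cyc-fromℕ (length S))))
  ... | ‵inject₁ j = trans (pieceEnd-inject₁ S a j) (cong (lookup (a ∷ S)) (sym (cyc-inject₁ j)))

  edges-subst : (eq : b ≡ c) (p : Path G a b) →
    edges G (walk (subst (Path G a) eq p)) ≡ edges G (walk p)
  edges-subst refl p = refl

  module _ (ch : Chain a S a) where

    arc : (i : Fin (suc (length S))) → Path G (lookup (a ∷ S) i) (lookup (a ∷ S) (cyc i))
    arc i = subst (Path G _) (pieceEnd-cyc S a i) (shortcutPath (piece ch i))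

    arc-⊆-piece : ∀ i → e ∈ edges G (walk (arc i)) → e ∈ edges G (piece ch i)
    arc-⊆-piece i e∈ = Any-resp-⊆ (edges-shortcut (piece ch i))
      (subst (_ ∈_) (edges-subst (pieceEnd-cyc S a i) (shortcutPath (piece ch i))) e∈)

    arc-⊆ : ∀ i → e ∈ edges G (walk (arc i)) → e ∈ chainEdges ch
    arc-⊆ i = piece-⊆ ch i ∘ arc-⊆-piece i

    arcs-disjoint : Unique (chainEdges ch) → ∀ i j → i ≢ j → EdgeDisjoint G (arc i) (arc j)
    arcs-disjoint u i j i≢j e e∈i e∈j =
      pieces-disjoint ch u i j i≢j (arc-⊆-piece i e∈i) (arc-⊆-piece j e∈j)

  doubledCycle-immersion : ∀ {r} (f : Fin r → Vtx G) → Injective _≡_ _≡_ f →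
    (A B : (i : Fin r) → Path G (f i) (f (cyc i))) →
    (∀ i j → i ≢ j → EdgeDisjoint G (A i) (A j)) → (∀ i j → i ≢ j → EdgeDisjoint G (B i) (B j)) →
    (∀ i j → EdgeDisjoint G (A i) (B j)) → Immersion (C2 r) G
  doubledCycle-immersion {r} f f-inj A B A-disjoint B-disjoint AB-disjoint =
    f , f-inj , image , disjoint
    where
    image : (e : Edge (C2 r)) → Path G (f (proj₁ (ends (C2 r) e))) (f (proj₂ (ends (C2 r) e)))
    image e with splitAt r e
    ... | inj₁ i = A i
    ... | inj₂ i = B i

    splitAt-injective : ∀ {e e′} → splitAt r e ≡ splitAt r e′ → e ≡ e′
    splitAt-injective {e} {e′} eq = begin
      e                      ≡⟨ join-splitAt r r e ⟨
      join r r (splitAt r e)  ≡⟨ cong (join r r) eq ⟩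
      join r r (splitAt r e′) ≡⟨ join-splitAt r r e′ ⟩
      e′                     ∎
      where open ≡-Reasoning

    disjoint : ∀ e e′ → e ≢ e′ → EdgeDisjoint G (image e) (image e′)
    disjoint e e′ e≢e′ with splitAt r e in eq | splitAt r e′ in eq′
    ... | inj₁ i | inj₁ j = A-disjoint i j λ { refl → e≢e′ (splitAt-injective (trans eq (sym eq′))) }
    ... | inj₂ i | inj₂ j = B-disjoint i j λ { refl → e≢e′ (splitAt-injective (trans eq (sym eq′))) }
    ... | inj₁ i | inj₂ j = AB-disjoint i j
    ... | inj₂ i | inj₁ j = λ d d∈Bi d∈Aj → AB-disjoint j i d d∈Aj d∈Bi

  closedChains⇒immersion : Unique (a ∷ S) → (ch ch′ : Chain a S a) →
    Unique (chainEdges ch) → Unique (chainEdges ch′) → Disjoint (chainEdges ch) (chainEdges ch′) →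
    Immersion (C2 (suc (length S))) G
  closedChains⇒immersion {a} {S} uS ch ch′ u u′ ch#ch′ =
    doubledCycle-immersion (lookup (a ∷ S)) (Unique⇒lookup-injective uS) (arc ch) (arc ch′)
      (arcs-disjoint ch u) (arcs-disjoint ch′ u′)
      (λ i j e e∈i e∈j → ch#ch′ (arc-⊆ ch i e∈i , arc-⊆ ch′ j e∈j))

  reversePath : Path G a b → Path G b a
  reversePath P = shortcutPath (reverseʷ (walk P))

  ∈-edges-reversePath⁻ : (P : Path G a b) → e ∈ edges G (walk (reversePath P)) → e ∈ edges G (walk P)
  ∈-edges-reversePath⁻ P =
    ∈-edges-reverseʷ⁻ (walk P) ∘ Any-resp-⊆ (edges-shortcut (reverseʷ (walk P)))

  module _ {x y : Vtx G} where

    closeWith : (P : Path G x y) → S ⊆ verts G (walk P) → Path G x y → Chain x S x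
    closeWith P S⊆P R = extend (split (walk P) S⊆P) (walk (reversePath R))

    chainEdges-closeWith : (P : Path G x y) (S⊆P : S ⊆ verts G (walk P)) (R : Path G x y) →
      chainEdges (closeWith P S⊆P R) ≡ edges G (walk P) ++ edges G (walk (reversePath R))
    chainEdges-closeWith P S⊆P R = begin
      chainEdges (extend (split (walk P) S⊆P) (walk (reversePath R)))
        ≡⟨ chainEdges-extend (split (walk P) S⊆P) (walk (reversePath R)) ⟩
      chainEdges (split (walk P) S⊆P) ++ edges G (walk (reversePath R))
        ≡⟨ cong (_++ edges G (walk (reversePath R))) (chainEdges-split (walk P) S⊆P) ⟩
      edges G (walk P) ++ edges G (walk (reversePath R)) ∎
      where open ≡-Reasoning

    ∈-closeWith⁻ : (P : Path G x y) (S⊆P : S ⊆ verts G (walk P)) (R : Path G x y) →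
      e ∈ chainEdges (closeWith P S⊆P R) → e ∈ edges G (walk P) ⊎ e ∈ edges G (walk R)
    ∈-closeWith⁻ P S⊆P R e∈
      with ∈-++⁻ (edges G (walk P)) (subst (_ ∈_) (chainEdges-closeWith P S⊆P R) e∈)
    ... | inj₁ e∈P  = inj₁ e∈P
    ... | inj₂ e∈R⁻ = inj₂ (∈-edges-reversePath⁻ R e∈R⁻)

    Unique-closeWith : (P : Path G x y) (S⊆P : S ⊆ verts G (walk P)) (R : Path G x y) →
      EdgeDisjoint G P R → Unique (chainEdges (closeWith P S⊆P R))
    Unique-closeWith P S⊆P R P#R = subst Unique (sym (chainEdges-closeWith P S⊆P R))
      (++⁺ (Unique-edges (walk P) (distinct P))
           (Unique-edges (walk (reversePath R)) (distinct (reversePath R)))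
           (λ (e∈P , e∈R⁻) → P#R _ e∈P (∈-edges-reversePath⁻ R e∈R⁻)))

    fourPaths⇒immersion : (P Q R R′ : Path G x y) → Unique (x ∷ S) →
      S ⊆ verts G (walk P) → S ⊆ verts G (walk Q) →
      EdgeDisjoint G P Q → EdgeDisjoint G P R → EdgeDisjoint G P R′ →
      EdgeDisjoint G R Q → EdgeDisjoint G R R′ → EdgeDisjoint G Q R′ →
      Immersion (C2 (suc (length S))) G
    fourPaths⇒immersion P Q R R′ uS S⊆P S⊆Q P#Q P#R P#R′ R#Q R#R′ Q#R′ =
      closedChains⇒immersion uS (closeWith P S⊆P R) (closeWith Q S⊆Q R′)
        (Unique-closeWith P S⊆P R P#R) (Unique-closeWith Q S⊆Q R′ Q#R′) PR#QR′
      where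
      PR#QR′ : Disjoint (chainEdges (closeWith P S⊆P R)) (chainEdges (closeWith Q S⊆Q R′))
      PR#QR′ (e∈PR , e∈QR′) with ∈-closeWith⁻ P S⊆P R e∈PR | ∈-closeWith⁻ Q S⊆Q R′ e∈QR′
      ... | inj₁ e∈P | inj₁ e∈Q  = P#Q _ e∈P e∈Q
      ... | inj₁ e∈P | inj₂ e∈R′ = P#R′ _ e∈P e∈R′
      ... | inj₂ e∈R | inj₁ e∈Q  = R#Q _ e∈R e∈Q
      ... | inj₂ e∈R | inj₂ e∈R′ = R#R′ _ e∈R e∈R′

avoidingInjection : ∀ {m} (i j : Fin (suc (suc m))) → i ≢ j →
  Σ (Fin m → Fin (suc (suc m))) λ g → Injective _≡_ _≡_ g × (∀ t → g t ≢ i) × (∀ t → g t ≢ j)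
avoidingInjection i j i≢j = g , g-injective , (λ t → punchInᵢ≢i i _) , g≢j
  where
  j′ = punchOut i≢j
  g = λ t → punchIn i (punchIn j′ t)
  g-injective : Injective _≡_ _≡_ g
  g-injective eq = punchIn-injective j′ _ _ (punchIn-injective i _ _ eq)
  g≢j : ∀ t → g t ≢ j
  g≢j t gt≡j =
    punchInᵢ≢i j′ t (punchIn-injective i _ _ (trans gt≡j (sym (punchIn-punchOut i≢j))))

mainTheorem12 : (G : Multigraph) → Loopless G → (x y : Vtx G) → x ≢ y →
    (r : ℕ) → 0 < r → (Ps : Fin 4 → Path G x y) →
    PairwiseEdgeDisjoint G Ps → Compatible G r Ps → Immersion (C2 r) G
mainTheorem12 G _ x y _ (suc n) _ Ps disjoint (i , j , i≢j , aligned , common)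
  with Aligned⇒commonSublist (Ps i) (Ps j) aligned common | avoidingInjection i j i≢j
... | S , |S|≡n , uS , S⊆P , S⊆Q | g , g-injective , g≢i , g≢j =
  subst (λ m → Immersion (C2 (suc m)) G) |S|≡n
    (fourPaths⇒immersion (Ps i) (Ps j) (Ps k) (Ps l) uS S⊆P S⊆Q
      (disjoint i j i≢j) (disjoint i k (g≢i zero ∘ sym)) (disjoint i l (g≢i (suc zero) ∘ sym))
      (disjoint k j (g≢j zero)) (disjoint k l (0≢1+n ∘ g-injective))
      (disjoint j l (g≢j (suc zero) ∘ sym)))
  where
  k = g zero
  l = g (suc zero)
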